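{- A graph $G$ is meshed if and only if for every metric triangle $uvw$ of $G$ there is a shortest path $P(u,v)$ between $u$ and $v$ such that all vertices of $P(u,v)$ are at the same distance from $w$.
   Context: All graphs are finite, simple, unweighted, undirected and connected, with shortest-path distance $d$. The interval is $I(u,v)=\{z: d(u,z)+d(z,v)=d(u,v)\}$. Three vertices $u,v,w$ form a metric triangle $uvw$ if the intervals $I(u,v),I(v,w),I(u,w)$ pairwise intersect only in their common endpoints. $G$ is meshed if for any three vertices $u,v,w$ with $d(v,w)=2$ there is a common neighbor $x$ of $v$ and $w$ with $2d(u,x)\le d(u,v)+d(u,w)$. -}

module Defs where

open import Level using (0ℓ)
open import Data.Nat using (ℕ; zero; suc; _+_; _*_; _≤_)
open import Data.Fin using (Fin)
open import Data.List using (List; []; _∷_)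
open import Data.List.Relation.Unary.All using (All)
open import Data.Product using (Σ; _×_; ∃; ∃-syntax)
open import Relation.Nullary using (¬_; Dec)
open import Relation.Binary.PropositionalEquality using (_≡_)

record Graph : Set₁ where
  field
    n     : ℕ
    Adj   : Fin n → Fin n → Set
    adj?  : ∀ u v → Dec (Adj u v)
    sym   : ∀ {u v} → Adj u v → Adj v u
    irrefl : ∀ {u} → ¬ Adj u u

module _ (G : Graph) where
  open Graph G

  V : Set
  V = Fin n

  data Walk : V → V → ℕ → Set where
    nil  : ∀ {u} → Walk u u 0
    cons : ∀ {u x v k} → Adj u x → Walk x v k → Walk u v (suc k)

  verts : ∀ {u v k} → Walk u v k → List V
  verts {u} nil = u ∷ []
  verts {u} (cons _ p) = u ∷ verts p

  Connected : Set
  Connected = ∀ u v → ∃[ k ] Walk u v k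

  IsDistance : (V → V → ℕ) → Set
  IsDistance d = ∀ u v → Walk u v (d u v) × (∀ k → Walk u v k → d u v ≤ k)

  module WithDist (d : V → V → ℕ) where

    _∈I[_,_] : V → V → V → Set
    z ∈I[ u , v ] = d u z + d z v ≡ d u v

    MetricTriangle : V → V → V → Set
    MetricTriangle u v w =
        (∀ z → z ∈I[ u , v ] → z ∈I[ v , w ] → z ≡ v)
      × (∀ z → z ∈I[ v , w ] → z ∈I[ u , w ] → z ≡ w)
      × (∀ z → z ∈I[ u , v ] → z ∈I[ u , w ] → z ≡ u)

    Meshed : Set
    Meshed = ∀ u v w → d v w ≡ 2 →
      ∃[ x ] (Adj v x × Adj w x × 2 * d u x ≤ d u v + d u w)

    TriangleProperty : Set
    TriangleProperty = ∀ u v w → MetricTriangle u v w →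
      Σ (Walk u v (d u v)) λ P → All (λ x → d x w ≡ d u w) (verts P)

{-# OPTIONS --safe #-}
module Submission where

-- Meshed ⇒ triangle property.  Fix w and say that a has no descent toward b if no
-- neighbour of a on a geodesic to b is closer to w.  In a metric triangle uvw, u has
-- no descent toward v and v none toward u.  For such a pair (a, b), step from a to
-- the neighbour a₁ toward b that is closest to w.  For a neighbour y of a₁ toward b,
-- meshedness gives a common neighbour z of a and y with 2 d(z,w) ≤ d(a,w) + d(y,w);
-- z again lies toward b, so d(a₁,w) ≤ d(z,w) forces d(a₁,w) ≤ d(y,w) and a₁ has no
-- descent toward b.  Induction on d(a, b), run from both ends, shows that a, a₁
-- and b are all at the same distance from w.
--
-- Triangle property ⇒ meshed.  Given d(v,w) = 2, move u toward v and w simultaneously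
-- while possible; the meshed inequality lifts back along such moves.  When no such
-- move exists, I(u,v) ∩ I(u,w) = {u}.  Then either v or w has a neighbour toward both
-- the other one and u, which is the vertex sought, or vwu is a metric triangle and the
-- midpoint of a geodesic from v to w at constant distance from u is.

open import Defs
open import Function.Bundles using (_⇔_; mk⇔)
open import Data.Nat using (ℕ; zero; suc; _+_; _*_; _≤_; _<?_; s≤s)
open import Data.Nat.Properties
open import Data.Fin using (Fin)
open import Data.Fin.Properties using (any?)
open import Data.List using (List; filter; allFin)
open import Data.List.Extrema ≤-totalOrder using (argmin; argmin-all; f[argmin]≤f[xs])
open import Data.List.Membership.Propositional.Properties using (∈-filter⁺; ∈-allFin)
open import Data.List.Relation.Unary.All as All using (All; []; _∷_)
open import Data.List.Relation.Unary.All.Properties using (all-filter)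
open import Data.Product using (Σ; ∃; _×_; _,_; proj₁; proj₂; map₂)
open import Data.Sum using (_⊎_; inj₁; inj₂)
open import Data.Empty using (⊥-elim)
open import Relation.Nullary using (¬_; Dec; yes; no; contradiction)
open import Relation.Nullary.Decidable using (_×-dec_)
open import Relation.Unary using (Pred; Decidable)
open import Relation.Binary.PropositionalEquality

minimiser : ∀ {m p} {P : Pred (Fin m) p} → Decidable P → (f : Fin m → ℕ) →
            ∃ P → ∃ λ x → P x × (∀ y → P y → f x ≤ f y)
minimiser {m} P? f (x₀ , Px₀) =
  argmin f x₀ candidates ,
  argmin-all f Px₀ (all-filter P? (allFin m)) ,
  λ y Py → All.lookup (f[argmin]≤f[xs] x₀ candidates) (∈-filter⁺ P? (∈-allFin y) Py)
  where
  candidates : List (Fin m)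
  candidates = filter P? (allFin m)

module _ (G : Graph) where
  open Graph G renaming (sym to adj-sym)

  _++ᵂ_ : ∀ {u v x j k} → Walk G u v j → Walk G v x k → Walk G u x (j + k)
  nil      ++ᵂ q = q
  cons e p ++ᵂ q = cons e (p ++ᵂ q)

  snoc : ∀ {u v x k} → Walk G u v k → Adj v x → Walk G u x (suc k)
  snoc nil        e = cons e nil
  snoc (cons f p) e = cons f (snoc p e)

  reverse : ∀ {u v k} → Walk G u v k → Walk G v u k
  reverse nil        = nil
  reverse (cons e p) = snoc (reverse p) (adj-sym e)

  walk₀⇒≡ : ∀ {u v} → Walk G u v 0 → u ≡ v
  walk₀⇒≡ nil = refl

  walk₁⇒adj : ∀ {u v} → Walk G u v 1 → Adj u v
  walk₁⇒adj (cons e nil) = e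

  walk₂-midpoint : ∀ {v w k} {Q : V G → Set} (P : Walk G v w k) → k ≡ 2 →
                   All Q (verts G P) → ∃ λ x → Adj v x × Adj x w × Q x × Q w
  walk₂-midpoint (cons vx (cons xw nil)) refl (_ ∷ Qx ∷ Qw ∷ []) = _ , vx , xw , Qx , Qw

  module _ (d : V G → V G → ℕ) (isDistance : IsDistance G d) where
    open WithDist G d

    d-minimal : ∀ {u v k} → Walk G u v k → d u v ≤ k
    d-minimal = proj₂ (isDistance _ _) _

    geodesic : ∀ u v → Walk G u v (d u v)
    geodesic u v = proj₁ (isDistance u v)

    d-sym : ∀ u v → d u v ≡ d v u
    d-sym u v = ≤-antisym (d-minimal (reverse (geodesic v u))) (d-minimal (reverse (geodesic u v)))

    d-triangle : ∀ x y z → d x z ≤ d x y + d y z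
    d-triangle x y z = d-minimal (geodesic x y ++ᵂ geodesic y z)

    d≡0⇒≡ : ∀ {u v} → d u v ≡ 0 → u ≡ v
    d≡0⇒≡ {u} {v} eq = walk₀⇒≡ (subst (Walk G u v) eq (geodesic u v))

    d≡1⇒adj : ∀ {u v} → d u v ≡ 1 → Adj u v
    d≡1⇒adj {u} {v} eq = walk₁⇒adj (subst (Walk G u v) eq (geodesic u v))

    adj⇒d≤1 : ∀ {x y} → Adj x y → d x y ≤ 1
    adj⇒d≤1 e = d-minimal (cons e nil)

    adj⇒d≡1 : ∀ {x y} → Adj x y → d x y ≡ 1
    adj⇒d≡1 {x} e = ≤-antisym (adj⇒d≤1 e)
      (n≢0⇒n>0 λ eq → irrefl (subst (Adj x) (sym (d≡0⇒≡ eq)) e))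

    adj⇒d≤suc : ∀ {x y} z → Adj x y → d x z ≤ suc (d y z)
    adj⇒d≤suc {x} {y} z e = ≤-trans (d-triangle x y z) (+-monoˡ-≤ (d y z) (adj⇒d≤1 e))

    I-sym : ∀ {z p q} → z ∈I[ p , q ] → z ∈I[ q , p ]
    I-sym {z} {p} {q} h = begin
      d q z + d z p  ≡⟨ cong₂ _+_ (d-sym q z) (d-sym z p) ⟩
      d z q + d p z  ≡⟨ +-comm (d z q) (d p z) ⟩
      d p z + d z q  ≡⟨ h ⟩
      d p q          ≡⟨ d-sym p q ⟩
      d q p          ∎
      where open ≡-Reasoning

    Step : V G → V G → V G → Set
    Step a b y = Adj a y × suc (d y b) ≡ d a b

    step? : ∀ a b y → Dec (Step a b y)
    step? a b y = adj? a y ×-dec (suc (d y b) ≟ d a b)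

    step-exists : ∀ {a b k} → d a b ≡ suc k → ∃ (Step a b)
    step-exists {a} {b} eq with subst (Walk G a b) eq (geodesic a b)
    ... | cons {x = y} e p =
      y , e , ≤-antisym (subst (suc (d y b) ≤_) (sym eq) (s≤s (d-minimal p))) (adj⇒d≤suc b e)

    step⇒∈I : ∀ {a b y} → Step a b y → y ∈I[ a , b ]
    step⇒∈I {b = b} {y} (e , eq) = trans (cong (_+ d y b) (adj⇒d≡1 e)) eq

    step-toward-interval : ∀ {p q z y} → Step p z y → z ∈I[ p , q ] → Step p q y
    step-toward-interval {p} {q} {z} {y} (py , yz) zpq = py , ≤-antisym
      (begin
        suc (d y q)          ≤⟨ s≤s (d-triangle y z q) ⟩
        suc (d y z) + d z q  ≡⟨ cong (_+ d z q) yz ⟩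
        d p z + d z q        ≡⟨ zpq ⟩
        d p q                ∎)
      (adj⇒d≤suc q py)
      where open ≤-Reasoning

    two-steps⇒d≡2 : ∀ {a b x y} → Step a b x → Step x b y → d a y ≡ 2
    two-steps⇒d≡2 {a} {b} {x} {y} (ax , xb) (xy , yb) = ≤-antisym
      (≤-trans (d-triangle a x y) (+-mono-≤ (adj⇒d≤1 ax) (adj⇒d≤1 xy)))
      (+-cancelʳ-≤ (d y b) 2 (d a y) (begin
        2 + d y b      ≡⟨ trans (cong suc yb) xb ⟩
        d a b          ≤⟨ d-triangle a y b ⟩
        d a y + d y b  ∎))
      where open ≤-Reasoning

    two-steps⇒middle-step : ∀ {a b x y z} → Step a b x → Step x b y →
                            Adj a z → Adj z y → Step a b z
    two-steps⇒middle-step {a} {b} {x} {y} {z} (_ , xb) (_ , yb) az zy = az , ≤-antisym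
      (begin
        suc (d z b)        ≤⟨ s≤s (adj⇒d≤suc b zy) ⟩
        suc (suc (d y b))  ≡⟨ cong suc yb ⟩
        suc (d x b)        ≡⟨ xb ⟩
        d a b              ∎)
      (adj⇒d≤suc b az)
      where open ≤-Reasoning

    IntervalsMeetOnlyAt : V G → V G → V G → Set
    IntervalsMeetOnlyAt a q r = ∀ z → z ∈I[ a , q ] → z ∈I[ a , r ] → z ≡ a

    metricTriangle⁺ : ∀ {u v w} → IntervalsMeetOnlyAt u v w → IntervalsMeetOnlyAt v u w →
                      IntervalsMeetOnlyAt w u v → MetricTriangle u v w
    metricTriangle⁺ meetᵘ meetᵛ meetʷ =
      (λ z zuv zvw → meetᵛ z (I-sym zuv) zvw) ,
      (λ z zvw zuw → meetʷ z (I-sym zuw) (I-sym zvw)) ,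
      meetᵘ

    metricTriangle⁻ : ∀ {u v w} → MetricTriangle u v w →
                      IntervalsMeetOnlyAt u v w × IntervalsMeetOnlyAt v u w
    metricTriangle⁻ (meetᵛ , _ , meetᵘ) = meetᵘ , λ z zvu zvw → meetᵛ z (I-sym zvu) zvw

    CommonStep : V G → V G → V G → V G → Set
    CommonStep a q r y = Step a q y × Step a r y

    commonStep? : ∀ a q r → Dec (∃ (CommonStep a q r))
    commonStep? a q r = any? λ y → step? a q y ×-dec step? a r y

    meetOnlyAt⇒¬commonStep : ∀ {a q r} → IntervalsMeetOnlyAt a q r → ¬ ∃ (CommonStep a q r)
    meetOnlyAt⇒¬commonStep {a} meet (y , stepᵠ , stepʳ) =
      irrefl (subst (Adj a) (meet y (step⇒∈I stepᵠ) (step⇒∈I stepʳ)) (proj₁ stepᵠ))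

    ≡⊎step : ∀ a z → z ≡ a ⊎ ∃ (Step a z)
    ≡⊎step a z = by-distance (d a z) refl
      where
      by-distance : ∀ k → d a z ≡ k → z ≡ a ⊎ ∃ (Step a z)
      by-distance zero    az = inj₁ (sym (d≡0⇒≡ az))
      by-distance (suc _) az = inj₂ (step-exists az)

    ¬commonStep⇒meetOnlyAt : ∀ {a q r} → ¬ ∃ (CommonStep a q r) → IntervalsMeetOnlyAt a q r
    ¬commonStep⇒meetOnlyAt {a} noStep z zaq zar with ≡⊎step a z
    ... | inj₁ z≡a    = z≡a
    ... | inj₂ (y , s) =
      ⊥-elim (noStep (y , step-toward-interval s zaq , step-toward-interval s zar))

    module _ (w : V G) where

      level : V G → ℕ
      level x = d x w

      NoDescent : V G → V G → Set
      NoDescent a b = ∀ y → Step a b y → level a ≤ level y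

      LevelGeodesic : V G → V G → ℕ → Set
      LevelGeodesic a b k = Σ (Walk G a b k) λ P → All (λ x → level x ≡ level a) (verts G P)

      meetOnlyAt⇒noDescent : ∀ {a b} → IntervalsMeetOnlyAt a b w → NoDescent a b
      meetOnlyAt⇒noDescent {a} meet y s with level y <? level a
      ... | no  y≮a = ≮⇒≥ y≮a
      ... | yes y<a = contradiction (y , s , proj₁ s , ≤-antisym y<a (adj⇒d≤suc w (proj₁ s)))
                                    (meetOnlyAt⇒¬commonStep meet)

      noDescent-toward-step : ∀ {a b a₁} → NoDescent b a → Step a b a₁ → NoDescent b a₁
      noDescent-toward-step noDesc s y t = noDesc y (step-toward-interval t (I-sym (step⇒∈I s)))

      meshed-level : Meshed → ∀ {a y} → d a y ≡ 2 →
                     ∃ λ z → Adj a z × Adj y z × 2 * level z ≤ level a + level y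
      meshed-level mesh {a} {y} ay≡2 with mesh w a y ay≡2
      ... | z , az , yz , le =
        z , az , yz , subst₂ (λ p q → 2 * p ≤ q) (d-sym w z) (cong₂ _+_ (d-sym w a) (d-sym w y)) le

      lowestStep-noDescent : Meshed → ∀ {a b a₁} → NoDescent a b → Step a b a₁ →
                             (∀ y → Step a b y → level a₁ ≤ level y) → NoDescent a₁ b
      lowestStep-noDescent mesh {a} {b} {a₁} noDesc s lowest y t
        with meshed-level mesh (two-steps⇒d≡2 s t)
      ... | z , az , yz , 2z≤a+y = +-cancelˡ-≤ (level a₁) (level a₁) (level y) (begin
        level a₁ + level a₁  ≡⟨ cong (level a₁ +_) (sym (+-identityʳ (level a₁))) ⟩
        2 * level a₁         ≤⟨ *-monoʳ-≤ 2 (lowest z (two-steps⇒middle-step s t az (adj-sym yz))) ⟩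
        2 * level z          ≤⟨ 2z≤a+y ⟩
        level a + level y    ≤⟨ +-monoˡ-≤ (level y) (noDesc a₁ s) ⟩
        level a₁ + level y   ∎)
        where open ≤-Reasoning

      level-geodesic : Meshed → ∀ k {a b} → d a b ≡ k → NoDescent a b → NoDescent b a →
                       level a ≡ level b × LevelGeodesic a b k
      lowestStep-levelGeodesic : Meshed → ∀ k {a b} → d a b ≡ suc k →
                                 NoDescent a b → NoDescent b a →
                                 ∃ λ a₁ → Step a b a₁ × level a₁ ≡ level b × LevelGeodesic a₁ b k

      level-geodesic mesh zero eq _ _ with d≡0⇒≡ eq
      ... | refl = refl , nil , refl ∷ []
      level-geodesic mesh (suc k) {a} {b} eq noDescᵃ noDescᵇ
        with lowestStep-levelGeodesic mesh k eq noDescᵃ noDescᵇ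
           | lowestStep-levelGeodesic mesh k (trans (d-sym b a) eq) noDescᵇ noDescᵃ
      ... | a₁ , sa₁ , a₁≈b , P , levels | b₁ , sb₁ , b₁≈a , _ =
        trans a≈a₁ a₁≈b , cons (proj₁ sa₁) P ,
        refl ∷ All.map (λ x≈a₁ → trans x≈a₁ (sym a≈a₁)) levels
        where
        open ≤-Reasoning
        a≈a₁ : level a ≡ level a₁
        a≈a₁ = ≤-antisym (noDescᵃ a₁ sa₁) (begin
          level a₁  ≡⟨ a₁≈b ⟩
          level b   ≤⟨ noDescᵇ b₁ sb₁ ⟩
          level b₁  ≡⟨ b₁≈a ⟩
          level a   ∎)

      lowestStep-levelGeodesic mesh k {a} {b} eq noDescᵃ noDescᵇ
        with minimiser (step? a b) level (step-exists eq)
      ... | a₁ , s , lowest = a₁ , s , level-geodesic mesh k (suc-injective (trans (proj₂ s) eq))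
        (lowestStep-noDescent mesh noDescᵃ s lowest) (noDescent-toward-step noDescᵇ s)

    meshed⇒triangleProperty : Meshed → TriangleProperty
    meshed⇒triangleProperty mesh u v w triangle with metricTriangle⁻ triangle
    ... | meetᵘ , meetᵛ = proj₂ (level-geodesic w mesh (d u v) refl
      (meetOnlyAt⇒noDescent w meetᵘ) (meetOnlyAt⇒noDescent w meetᵛ))

    MeshWitness : V G → V G → V G → V G → Set
    MeshWitness u v w x = Adj v x × Adj w x × 2 * d u x ≤ d u v + d u w

    meshWitness-swap : ∀ {u v w x} → MeshWitness u v w x → MeshWitness u w v x
    meshWitness-swap {u} {v} {w} {x} (vx , wx , le) =
      wx , vx , subst (2 * d u x ≤_) (+-comm (d u v) (d u w)) le

    meshWitness-lift : ∀ {u v w u₁ x} → CommonStep u v w u₁ →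
                       MeshWitness u₁ v w x → MeshWitness u v w x
    meshWitness-lift {u} {v} {w} {u₁} {x} ((uu₁ , u₁v) , (_ , u₁w)) (vx , wx , le) =
      vx , wx , (begin
        2 * d u x                    ≤⟨ *-monoʳ-≤ 2 (adj⇒d≤suc x uu₁) ⟩
        2 * suc (d u₁ x)             ≡⟨ *-suc 2 (d u₁ x) ⟩
        2 + 2 * d u₁ x               ≤⟨ +-monoʳ-≤ 2 le ⟩
        2 + (d u₁ v + d u₁ w)        ≡⟨ cong suc (sym (+-suc (d u₁ v) (d u₁ w))) ⟩
        suc (d u₁ v) + suc (d u₁ w)  ≡⟨ cong₂ _+_ u₁v u₁w ⟩
        d u v + d u w                ∎)
      where open ≤-Reasoning

    commonStep⇒meshWitness : ∀ {u v w x} → d v w ≡ 2 → CommonStep v w u x →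
                             MeshWitness u v w x
    commonStep⇒meshWitness {u} {v} {w} {x} vw≡2 ((vx , xw) , (_ , xu)) =
      vx , adj-sym (d≡1⇒adj (suc-injective (trans xw vw≡2))) , (begin
        2 * d u x            ≡⟨ cong (d u x +_) (+-identityʳ (d u x)) ⟩
        d u x + d u x        ≤⟨ +-monoʳ-≤ (d u x) (≤-pred ux<2+uw) ⟩
        d u x + suc (d u w)  ≡⟨ +-suc (d u x) (d u w) ⟩
        suc (d u x) + d u w  ≡⟨ cong (_+ d u w) 1+ux≡uv ⟩
        d u v + d u w        ∎)
      where
      open ≤-Reasoning
      1+ux≡uv : suc (d u x) ≡ d u v
      1+ux≡uv = trans (cong suc (d-sym u x)) (trans xu (d-sym v u))
      ux<2+uw : suc (d u x) ≤ 2 + d u w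
      ux<2+uw = begin
        suc (d u x)    ≡⟨ 1+ux≡uv ⟩
        d u v          ≤⟨ d-triangle u w v ⟩
        d u w + d w v  ≡⟨ cong (d u w +_) (trans (d-sym w v) vw≡2) ⟩
        d u w + 2      ≡⟨ +-comm (d u w) 2 ⟩
        2 + d u w      ∎

    equidistant⇒meshWitness : ∀ {u v w x} → Adj v x → Adj w x → d u x ≡ d u v → d u w ≡ d u v →
                              MeshWitness u v w x
    equidistant⇒meshWitness {u} {v} {w} {x} vx wx ux≡uv uw≡uv = vx , wx , ≤-reflexive (begin
      2 * d u x      ≡⟨ cong (2 *_) ux≡uv ⟩
      2 * d u v      ≡⟨ cong (d u v +_) (+-identityʳ (d u v)) ⟩
      d u v + d u v  ≡⟨ cong (d u v +_) (sym uw≡uv) ⟩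
      d u v + d u w  ∎)
      where open ≡-Reasoning

    triangleProperty⇒meshed : TriangleProperty → Meshed
    triangleProperty⇒meshed triangleProperty u₀ v w vw≡2 = descend (d u₀ v) u₀ refl
      where
      wv≡2 : d w v ≡ 2
      wv≡2 = trans (d-sym w v) vw≡2

      atBase : ∀ u → ¬ ∃ (CommonStep u v w) → ∃ (MeshWitness u v w)
      atBase u noStepᵘ with commonStep? v w u | commonStep? w v u
      ... | yes (x , s) | _           = x , commonStep⇒meshWitness vw≡2 s
      ... | no _        | yes (x , s) = x , meshWitness-swap (commonStep⇒meshWitness wv≡2 s)
      ... | no noStepᵛ  | no noStepʷ
        with triangleProperty v w u (metricTriangle⁺ (¬commonStep⇒meetOnlyAt noStepᵛ)
               (¬commonStep⇒meetOnlyAt noStepʷ) (¬commonStep⇒meetOnlyAt noStepᵘ))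
      ...   | P , levels with walk₂-midpoint P vw≡2 levels
      ...     | x , vx , xw , xu≡vu , wu≡vu = x , equidistant⇒meshWitness vx (adj-sym xw)
                  (trans (d-sym u x) (trans xu≡vu (d-sym v u)))
                  (trans (d-sym u w) (trans wu≡vu (d-sym v u)))

      descend : ∀ k u → d u v ≡ k → ∃ (MeshWitness u v w)
      descend k u uv≡k with commonStep? u v w
      ... | no noStep = atBase u noStep
      descend zero    u uv≡0 | yes (_ , (_ , u₁v) , _) = contradiction (trans u₁v uv≡0) 1+n≢0
      descend (suc k) u uv≡k | yes (u₁ , s) =
        map₂ (meshWitness-lift s) (descend k u₁ (suc-injective (trans (proj₂ (proj₁ s)) uv≡k)))

theorem3 : (G : Graph) → Connected G → (d : V G → V G → ℕ) → IsDistance G d →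
           WithDist.Meshed G d ⇔ WithDist.TriangleProperty G d
theorem3 G _ d isDistance =
  mk⇔ (meshed⇒triangleProperty G d isDistance) (triangleProperty⇒meshed G d isDistance)
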